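{- Let $G=(V,E)$ be a graph on $n$ vertices and $k\ge 0$ an integer with $n>k+1$, such that none of Rules (R1), (R2), (R3) below applies to $(G,k)$. Let $S$ be a minimum-size set of pairs of vertices such that $H=(V,E\triangle S)$ is a cograph, with $|S|\le k$. Let $T$ be the canonical cotree of $H$ and $T'$ the subtree of $T$ induced by the nodes $u$ with $|De(u)|\ge k+2$. Then every edge of $T'$ belongs to an edit path, except possibly at most $k$ edges, all incident to the root of $T'$.
   Context: A cograph is a graph with no induced $P_4$. The canonical cotree of a cograph $H$ is a rooted tree whose leaves are the vertices of $H$, whose internal nodes have at least two children and labels $+$ or $\oplus$ alternating along every root-leaf path (children of $+$-nodes are $\oplus$ and vice versa), such that two vertices are adjacent in $H$ iff their least common ancestor is labelled $\oplus$. For a node $u$, $De(u)$ is the set of leaves descending from $u$. For each pair $xy\in S$ with least common ancestor $z$ in $T$, the two descending paths of $T$ from $z$ to $x$ and from $z$ to $y$ are called edit paths. A module is a set $X$ of vertices all having the same neighborhood outside $X$; a comodule is a module which is the vertex set of a connected component of $G$ or of the complement of $G$. Rules: (R1) if $G$ has a comodule $C$ inducing a cograph, remove $C$; (R2) if $G$ has a module $M$ with $|M|>k+1$ inducing an independent set, delete vertices of $M$ until it has size $k+1$; (R3) if $X$ is a module of $G$ which is not a comodule and $G[X]$ contains an edge, add a disjoint copy of $G[X]$ and replace the original $G[X]$ by an independent set on $X$ (keeping adjacencies between $X$ and $V\setminus X$). -}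

module Defs where

open import Data.Nat using (ℕ; zero; suc; _+_; _≤_; _<_)
open import Data.Fin using (Fin) renaming (_<_ to _<ᶠ_)
open import Data.Fin.Subset using (Subset; _∈_; _∉_; ∣_∣)
open import Data.Bool using (Bool; true; false)
open import Data.List using (List; []; _∷_; _++_; length; allFin)
open import Data.List.Relation.Unary.All using (All)
open import Data.List.Relation.Unary.Unique.Propositional using (Unique)
open import Data.List.Relation.Binary.Permutation.Propositional using (_↭_)
import Data.List.Membership.Propositional as LM
open import Data.Product using (Σ; ∃; ∃-syntax; _×_; _,_; proj₁; proj₂)
open import Data.Sum using (_⊎_)
open import Data.Unit using (⊤)
open import Relation.Nullary using (¬_)
open import Relation.Binary.PropositionalEquality using (_≡_; _≢_)
open import Function.Bundles using (_⇔_)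

record Graph (n : ℕ) : Set where
  field
    adj   : Fin n → Fin n → Bool
    sym   : ∀ x y → adj x y ≡ adj y x
    irrefl : ∀ x → adj x x ≡ false
open Graph public

Adj : ∀ {n} → Graph n → Fin n → Fin n → Set
Adj G x y = adj G x y ≡ true

CoAdj : ∀ {n} → Graph n → Fin n → Fin n → Set
CoAdj G x y = (x ≢ y) × (adj G x y ≡ false)

HasInducedP4In : ∀ {n} → (Fin n → Fin n → Set) → (Fin n → Set) → Set
HasInducedP4In {n} A P =
  Σ (Fin n) λ a → Σ (Fin n) λ b → Σ (Fin n) λ c → Σ (Fin n) λ d →
    P a × P b × P c × P d ×
    a ≢ b × a ≢ c × a ≢ d × b ≢ c × b ≢ d × c ≢ d ×
    A a b × A b c × A c d × ¬ A a c × ¬ A b d × ¬ A a d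

IsCograph : ∀ {n} → (Fin n → Fin n → Set) → Set
IsCograph A = ¬ HasInducedP4In A (λ _ → ⊤)

IsModule : ∀ {n} → Graph n → Subset n → Set
IsModule {n} G M = ∀ (x y z : Fin n) → x ∈ M → y ∈ M → z ∉ M → adj G x z ≡ adj G y z

data Reach {n} (A : Fin n → Fin n → Set) (C : Subset n) : Fin n → Fin n → Set where
  stay : ∀ {x} → x ∈ C → Reach A C x x
  step : ∀ {x y z} → x ∈ C → A x y → Reach A C y z → Reach A C x z

IsComponent : ∀ {n} → (Fin n → Fin n → Set) → Subset n → Set
IsComponent {n} A C =
  (∃[ x ] x ∈ C) ×
  (∀ x y → x ∈ C → y ∈ C → Reach A C x y) ×
  (∀ x z → x ∈ C → z ∉ C → ¬ A x z)

IsComodule : ∀ {n} → Graph n → Subset n → Set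
IsComodule G C = IsModule G C × (IsComponent (Adj G) C ⊎ IsComponent (CoAdj G) C)

IsIndependent : ∀ {n} → Graph n → Subset n → Set
IsIndependent {n} G M = ∀ (x y : Fin n) → x ∈ M → y ∈ M → adj G x y ≡ false

R1Applies : ∀ {n} → Graph n → ℕ → Set
R1Applies {n} G k = ∃[ C ] (IsComodule G C × ¬ HasInducedP4In (Adj G) (_∈ C))

R2Applies : ∀ {n} → Graph n → ℕ → Set
R2Applies {n} G k = ∃[ M ] (IsModule G M × suc k < ∣ M ∣ × IsIndependent G M)

R3Applies : ∀ {n} → Graph n → ℕ → Set
R3Applies {n} G k =
  ∃[ X ] (IsModule G X × ¬ IsComodule G X ×
          ∃[ x ] ∃[ y ] (x ∈ X × y ∈ X × adj G x y ≡ true))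

NoRuleApplies : ∀ {n} → Graph n → ℕ → Set
NoRuleApplies G k = ¬ R1Applies G k × ¬ R2Applies G k × ¬ R3Applies G k

-- Edit sets: a set of unordered pairs, represented as a duplicate-free
-- list of ordered pairs (x , y) with x < y.  |S| = length S.

EditSet : ℕ → Set
EditSet n = List (Fin n × Fin n)

ValidEditSet : ∀ {n} → EditSet n → Set
ValidEditSet S = All (λ p → proj₁ p <ᶠ proj₂ p) S × Unique S

InS : ∀ {n} → EditSet n → Fin n → Fin n → Set
InS S x y = LM._∈_ (x , y) S ⊎ LM._∈_ (y , x) S

EditAdj : ∀ {n} → Graph n → EditSet n → Fin n → Fin n → Set
EditAdj G S x y = (adj G x y ≡ true × ¬ InS S x y) ⊎ (adj G x y ≡ false × InS S x y)

IsMinCographEdit : ∀ {n} → Graph n → EditSet n → Set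
IsMinCographEdit {n} G S =
  ValidEditSet S × IsCograph (EditAdj G S) ×
  (∀ (S' : EditSet n) → ValidEditSet S' → IsCograph (EditAdj G S') → length S ≤ length S')

data Label : Set where
  plus  : Label   -- parallel node (lca labelled + : non-adjacent)
  oplus : Label   -- series node   (lca labelled ⊕ : adjacent)

data Cotree (n : ℕ) : Set where
  leaf : Fin n → Cotree n
  node : Label → List (Cotree n) → Cotree n

leaves  : ∀ {n} → Cotree n → List (Fin n)
leavesL : ∀ {n} → List (Cotree n) → List (Fin n)
leaves (leaf x) = x ∷ []
leaves (node l ts) = leavesL ts
leavesL [] = []
leavesL (t ∷ ts) = leaves t ++ leavesL ts

data Lookup {A : Set} : List A → ℕ → A → Set where
  here  : ∀ {x xs} → Lookup (x ∷ xs) zero x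
  there : ∀ {x xs i y} → Lookup xs i y → Lookup (x ∷ xs) (suc i) y

-- Nodes of a cotree are addressed by positions (lists of child indices
-- from the root).  NodeAt T p s : the subtree of T at position p is s.
Position : Set
Position = List ℕ

data NodeAt {n} : Cotree n → Position → Cotree n → Set where
  root  : ∀ {t} → NodeAt t [] t
  child : ∀ {l ts i t p s} → Lookup ts i t → NodeAt t p s → NodeAt (node l ts) (i ∷ p) s

-- p is a prefix of q (p is an ancestor-or-equal of q)
_≼_ : Position → Position → Set
p ≼ q = ∃[ r ] (p ++ r ≡ q)

IsLCA : ∀ {n} → Cotree n → Fin n → Fin n → Position → Label → Set
IsLCA T x y p l =
  ∃[ ts ] (NodeAt T p (node l ts) ×
           LM._∈_ x (leavesL ts) × LM._∈_ y (leavesL ts) ×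
           (∀ i c → Lookup ts i c → ¬ (LM._∈_ x (leaves c) × LM._∈_ y (leaves c))))

IsCanonicalCotree : ∀ {n} → (Fin n → Fin n → Set) → Cotree n → Set
IsCanonicalCotree {n} A T =
  (leaves T ↭ allFin n) ×
  (∀ p l ts → NodeAt T p (node l ts) → 2 ≤ length ts) ×
  (∀ p l ts i l' ts' → NodeAt T p (node l ts) → Lookup ts i (node l' ts') → l' ≢ l) ×
  (∀ x y p l → x ≢ y → IsLCA T x y p l → (A x y ⇔ (l ≡ oplus)))

size : ∀ {n} → Cotree n → ℕ
size t = length (leaves t)

-- (p , i) is an edge of T' : the edge from the node at p to its i-th
-- child, both endpoints having |De| ≥ k + 2
IsT'Edge : ∀ {n} → ℕ → Cotree n → Position → ℕ → Set
IsT'Edge k T p i =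
  ∃[ l ] ∃[ ts ] ∃[ c ] (NodeAt T p (node l ts) × Lookup ts i c ×
                         k + 2 ≤ size (node l ts) × k + 2 ≤ size c)

-- the edge (p , p ++ [i]) lies on an edit path of some pair xy ∈ S:
-- it lies on the descending path from lca(x,y) (at position z) to x or to y
OnEditPath : ∀ {n} → Cotree n → EditSet n → Position → ℕ → Set
OnEditPath {n} T S p i =
  ∃[ x ] ∃[ y ] (LM._∈_ (x , y) S ×
    ∃[ z ] ∃[ l ] (IsLCA T x y z l ×
      ∃[ v ] ((v ≡ x ⊎ v ≡ y) × ∃[ pv ] (NodeAt T pv (leaf v) ×
         z ≼ p × (p ++ (i ∷ [])) ≼ pv))))

-- A T'-edge into a subtree c that lies on no edit path leaves c uncrossed: no edited
-- pair has exactly one endpoint below c.  Then every vertex outside c meets all of c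
-- through the same least common ancestor, so the leaves of c form a module of G.
-- Below the root, c has a sibling and its parent has a sibling, and these two lcas
-- carry different labels; so some leaf of c has both a neighbour and a non-neighbour
-- outside c, the module is not a comodule, and with |c| ≥ k + 2 either R2 (c
-- independent) or R3 (c contains an edge) applies.  At the root, an uncrossed child
-- that contains no first endpoint of an edited pair is untouched by S; since the root
-- and the child carry different labels it is a comodule of G inducing a cograph, and
-- R1 applies.  Hence the exceptional edges hang below the at most |S| ≤ k root
-- children that contain a first endpoint of an edited pair.

module Submission where

open import Defs
open import Data.Nat using (ℕ; _≤_; _<_; suc)
open import Data.List using (List; []; length)
open import Data.List.Membership.Propositional using (_∈_)
open import Data.Product using (_×_; ∃-syntax)
open import Relation.Nullary using (¬_)
open import Relation.Binary.PropositionalEquality using (_≡_)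

open import Data.Nat using (_+_; z≤n; s≤s; _≟_)
open import Data.Nat.Properties using (≤-trans; ≤-reflexive; +-comm; m≤n+m)
open import Data.Bool using (Bool; true; false)
import Data.Bool as Bool
open import Data.Bool.Properties using (T-≡; ¬-not)
open import Data.Empty using (⊥-elim)
open import Data.Fin using (Fin) renaming (_≟_ to _≟ᶠ_)
open import Data.Fin.Subset using (Subset; ∣_∣; _-_) renaming (_∈_ to _∈ₛ_; _∉_ to _∉ₛ_)
open import Data.Fin.Subset.Properties using (x∈p⇒∣p-x∣<∣p∣; x∈p∧x≢y⇒x∈p-y) renaming (_∈?_ to _∈ₛ?_)
import Data.Fin.Properties as Fin
open import Data.List using (_∷_; _++_; map)
open import Data.List.Properties using (++-assoc; length-map)
import Data.List.Relation.Unary.All as All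
import Data.List.Relation.Unary.All.Properties as All
open import Data.List.Relation.Unary.Any using (here; there)
open import Data.List.Relation.Unary.AllPairs using ([]; _∷_)
open import Data.List.Relation.Unary.Unique.Propositional using (Unique)
open import Data.List.Relation.Unary.Unique.Propositional.Properties using (allFin⁺)
open import Data.List.Relation.Binary.Disjoint.Propositional using (Disjoint)
open import Data.List.Relation.Binary.Permutation.Propositional using (_↭_; ↭-sym; ↭⇒↭ₛ)
open import Data.List.Relation.Binary.Permutation.Propositional.Properties using (∈-resp-↭)
import Data.List.Relation.Binary.Permutation.Setoid.Properties as ↭ₛ
open import Data.List.Membership.Propositional using (_∉_)
open import Data.List.Membership.Propositional.Properties using (∈-++⁺ˡ; ∈-++⁺ʳ; ∈-++⁻; ∈-map⁺; ∈-allFin)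
import Data.List.Membership.DecPropositional as DecMembership
open import Data.Product using (_,_; proj₁; proj₂)
open import Data.Sum using (_⊎_; inj₁; inj₂; [_,_]′)
open import Data.Vec using (tabulate)
open import Data.Vec.Properties using (lookup⇒[]=; []=⇒lookup; lookup∘tabulate)
open import Function.Bundles using (_⇔_; Equivalence)
open import Relation.Nullary using (Dec; yes; no; contradiction)
open import Relation.Nullary.Decidable using (⌊_⌋; toWitness; fromWitness; _×-dec_)
open import Relation.Binary.PropositionalEquality using (_≢_; refl; trans; cong; subst; setoid)
  renaming (sym to ≡-sym)

module _ {A : Set} where

  Unique-resp-↭ : ∀ {xs ys : List A} → xs ↭ ys → Unique xs → Unique ys
  Unique-resp-↭ p = ↭ₛ.Unique-resp-↭ (setoid A) (↭⇒↭ₛ p)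

  Unique-++⁻ˡ : ∀ (xs : List A) {ys} → Unique (xs ++ ys) → Unique xs
  Unique-++⁻ˡ []       _        = []
  Unique-++⁻ˡ (x ∷ xs) (x∉ ∷ u) = All.++⁻ˡ xs x∉ ∷ Unique-++⁻ˡ xs u

  Unique-++⁻ʳ : ∀ (xs : List A) {ys} → Unique (xs ++ ys) → Unique ys
  Unique-++⁻ʳ []       u       = u
  Unique-++⁻ʳ (x ∷ xs) (_ ∷ u) = Unique-++⁻ʳ xs u

  Unique-++⇒Disjoint : ∀ (xs : List A) {ys} → Unique (xs ++ ys) → Disjoint xs ys
  Unique-++⇒Disjoint (x ∷ xs) (x∉ ∷ _) (here refl , v∈ys) = All.lookup (All.++⁻ʳ xs x∉) v∈ys refl
  Unique-++⇒Disjoint (x ∷ xs) (_ ∷ u)  (there v∈xs , v∈ys) = Unique-++⇒Disjoint xs u (v∈xs , v∈ys)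

module _ {n : ℕ} where
  open DecMembership (_≟ᶠ_ {n}) using (_∈?_)

  fromList : List (Fin n) → Subset n
  fromList xs = tabulate (λ x → ⌊ x ∈? xs ⌋)

  ∈-fromList⁺ : ∀ {xs x} → x ∈ xs → x ∈ₛ fromList xs
  ∈-fromList⁺ {xs} {x} x∈xs =
    lookup⇒[]= x (fromList xs) (trans (lookup∘tabulate _ x) (Equivalence.to T-≡ (fromWitness x∈xs)))

  ∈-fromList⁻ : ∀ {xs x} → x ∈ₛ fromList xs → x ∈ xs
  ∈-fromList⁻ {xs} {x} x∈ =
    toWitness {a? = x ∈? xs}
      (Equivalence.from T-≡ (trans (≡-sym (lookup∘tabulate _ x)) ([]=⇒lookup x∈)))

  length≤∣_∣ : ∀ (p : Subset n) {xs} → Unique xs → (∀ {x} → x ∈ xs → x ∈ₛ p) → length xs ≤ ∣ p ∣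
  length≤∣ p ∣ []             _  = z≤n
  length≤∣ p ∣ {x ∷ xs} (x∉ ∷ u) ⊆p =
    ≤-trans
      (s≤s (length≤∣ p - x ∣ u λ y∈ →
        x∈p∧x≢y⇒x∈p-y (⊆p (there y∈)) (λ y≡x → All.lookup x∉ y∈ (≡-sym y≡x))))
      (x∈p⇒∣p-x∣<∣p∣ (⊆p (here refl)))

  Lookup-functional : ∀ {ts : List (Cotree n)} {i c d} → Lookup ts i c → Lookup ts i d → c ≡ d
  Lookup-functional here      here      = refl
  Lookup-functional (there l) (there m) = Lookup-functional l m

  ∈-leaves-child : ∀ {ts : List (Cotree n)} {i c x} → Lookup ts i c → x ∈ leaves c → x ∈ leavesL ts
  ∈-leaves-child here                x∈c = ∈-++⁺ˡ x∈c
  ∈-leaves-child {t ∷ _} (there lk) x∈c = ∈-++⁺ʳ (leaves t) (∈-leaves-child lk x∈c)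

  ∈-leavesL⁻ : ∀ (ts : List (Cotree n)) {x} → x ∈ leavesL ts → ∃[ i ] ∃[ c ] (Lookup ts i c × x ∈ leaves c)
  ∈-leavesL⁻ (t ∷ ts) x∈ with ∈-++⁻ (leaves t) x∈
  ... | inj₁ x∈t  = 0 , t , here , x∈t
  ... | inj₂ x∈ts with ∈-leavesL⁻ ts x∈ts
  ...   | i , c , lk , x∈c = suc i , c , there lk , x∈c

  Unique-child : ∀ {ts : List (Cotree n)} {i c} → Unique (leavesL ts) → Lookup ts i c → Unique (leaves c)
  Unique-child {t ∷ _} u here       = Unique-++⁻ˡ (leaves t) u
  Unique-child {t ∷ _} u (there lk) = Unique-child (Unique-++⁻ʳ (leaves t) u) lk

  children-disjoint : ∀ {ts : List (Cotree n)} {i j c d x} → Unique (leavesL ts) →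
                      Lookup ts i c → Lookup ts j d → x ∈ leaves c → x ∈ leaves d → i ≡ j
  children-disjoint u here here _ _ = refl
  children-disjoint {t ∷ _} u here (there lk) x∈c x∈d =
    ⊥-elim (Unique-++⇒Disjoint (leaves t) u (x∈c , ∈-leaves-child lk x∈d))
  children-disjoint {t ∷ _} u (there lk) here x∈c x∈d =
    ⊥-elim (Unique-++⇒Disjoint (leaves t) u (x∈d , ∈-leaves-child lk x∈c))
  children-disjoint {t ∷ _} u (there lk) (there lk′) x∈c x∈d =
    cong suc (children-disjoint (Unique-++⁻ʳ (leaves t) u) lk lk′ x∈c x∈d)

  distinct-children⇒≢ : ∀ {ts : List (Cotree n)} {i j c d x y} → Unique (leavesL ts) → i ≢ j →
                        Lookup ts i c → Lookup ts j d → x ∈ leaves c → y ∈ leaves d → x ≢ y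
  distinct-children⇒≢ u i≢j lc ld x∈c y∈d refl = i≢j (children-disjoint u lc ld x∈c y∈d)

  NodeAt-root : ∀ {t s : Cotree n} → NodeAt t [] s → t ≡ s
  NodeAt-root root = refl

  NodeAt-++ : ∀ {t u w : Cotree n} {p r} → NodeAt t p u → NodeAt u r w → NodeAt t (p ++ r) w
  NodeAt-++ root         nb = nb
  NodeAt-++ (child l na) nb = child l (NodeAt-++ na nb)

  NodeAt-leaves : ∀ {t s : Cotree n} {p x} → NodeAt t p s → x ∈ leaves s → x ∈ leaves t
  NodeAt-leaves root          x∈ = x∈
  NodeAt-leaves (child lk na) x∈ = ∈-leaves-child lk (NodeAt-leaves na x∈)

  NodeAt-Unique : ∀ {t s : Cotree n} {p} → Unique (leaves t) → NodeAt t p s → Unique (leaves s)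
  NodeAt-Unique u root          = u
  NodeAt-Unique u (child lk na) = NodeAt-Unique (Unique-child u lk) na

  NodeAt-parent : ∀ {t s : Cotree n} {a p} → NodeAt t (a ∷ p) s →
                  ∃[ q ] ∃[ j ] ∃[ l ] ∃[ ts ] (NodeAt t q (node l ts) × Lookup ts j s)
  NodeAt-parent (child {l = l} {ts} lk root) = [] , _ , l , ts , root , lk
  NodeAt-parent (child lk na@(child _ _)) with NodeAt-parent na
  ... | q , j , l , ts , nq , lj = _ ∷ q , j , l , ts , child lk nq , lj

  leaf-position  : ∀ (s : Cotree n) {x} → x ∈ leaves s → ∃[ r ] NodeAt s r (leaf x)
  leaf-positionL : ∀ (ts : List (Cotree n)) {x} → x ∈ leavesL ts →
                   ∃[ i ] ∃[ c ] ∃[ r ] (Lookup ts i c × NodeAt c r (leaf x))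
  leaf-position (leaf y) (here refl) = [] , root
  leaf-position (node l ts) x∈ with leaf-positionL ts x∈
  ... | i , c , r , lk , na = i ∷ r , child lk na
  leaf-positionL (t ∷ ts) x∈ with ∈-++⁻ (leaves t) x∈
  ... | inj₁ x∈t with leaf-position t x∈t
  ...   | r , na = 0 , t , r , here , na
  leaf-positionL (t ∷ ts) x∈ | inj₂ x∈ts with leaf-positionL ts x∈ts
  ...   | i , c , r , lk , na = suc i , c , r , there lk , na

  IsLCA-sym : ∀ {t : Cotree n} {x y q l} → IsLCA t x y q l → IsLCA t y x q l
  IsLCA-sym (ts , na , x∈ , y∈ , sep) =
    ts , na , y∈ , x∈ , λ i c lk (y∈c , x∈c) → sep i c lk (x∈c , y∈c)

  IsLCA-child : ∀ {c : Cotree n} {x y q l l′ ts i} → IsLCA c x y q l → Lookup ts i c →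
                IsLCA (node l′ ts) x y (i ∷ q) l
  IsLCA-child (ts , na , x∈ , y∈ , sep) lk = ts , child lk na , x∈ , y∈ , sep

  IsLCA-siblings : ∀ {t : Cotree n} {q l ts i j c d x y} → NodeAt t q (node l ts) → Unique (leavesL ts) →
                   Lookup ts i c → Lookup ts j d → i ≢ j → x ∈ leaves c → y ∈ leaves d → IsLCA t x y q l
  IsLCA-siblings na u lc ld i≢j x∈c y∈d =
    _ , na , ∈-leaves-child lc x∈c , ∈-leaves-child ld y∈d ,
    λ m e lm (x∈e , y∈e) →
      i≢j (trans (children-disjoint u lc lm x∈c x∈e) (≡-sym (children-disjoint u ld lm y∈d y∈e)))

  IsLCA-outside-child : ∀ {t : Cotree n} {q l ts j d y z} → NodeAt t q (node l ts) → Unique (leavesL ts) →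
                        Lookup ts j d → y ∈ leaves d → z ∈ leavesL ts → z ∉ leaves d → IsLCA t y z q l
  IsLCA-outside-child {ts = ts} {j} na u ld y∈d z∈ z∉d with ∈-leavesL⁻ ts z∈
  ... | j′ , d′ , ld′ , z∈d′ with j ≟ j′
  ...   | yes refl = ⊥-elim (z∉d (subst (λ e → _ ∈ leaves e) (Lookup-functional ld′ ld) z∈d′))
  ...   | no j≢j′  = IsLCA-siblings na u ld ld′ j≢j′ y∈d z∈d′

  lca-outside-child : ∀ {t : Cotree n} {p l ts i c z} → Unique (leaves t) →
                      NodeAt t p (node l ts) → Lookup ts i c → z ∈ leaves t → z ∉ leaves c →
                      ∃[ q ] ∃[ l′ ] (q ≼ p × (∀ {y} → y ∈ leaves c → IsLCA t y z q l′))
  lca-outside-child {l = l} u root lk z∈ z∉c =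
    [] , l , ([] , refl) , λ y∈c → IsLCA-outside-child root u lk y∈c z∈ z∉c
  lca-outside-child {z = z} u (child {i = j} {t = c₀} lj na) lk z∈ z∉c with z ∈? leaves c₀
  ... | yes z∈c₀ with lca-outside-child (Unique-child u lj) na lk z∈c₀ z∉c
  ...   | q , l′ , (r , q++r≡p) , lca =
    j ∷ q , l′ , (r , cong (j ∷_) q++r≡p) , λ y∈c → IsLCA-child (lca y∈c) lj
  lca-outside-child {z = z} u (child {l = l₀} {i = j} {t = c₀} {p = p} lj na) lk z∈ z∉c | no z∉c₀ =
    [] , l₀ , (j ∷ p , refl) ,
    λ y∈c → IsLCA-outside-child root u lj (NodeAt-leaves na (∈-leaves-child lk y∈c)) z∈ z∉c₀

  Branching : Cotree n → Set
  Branching s = ∀ r l ts → NodeAt s r (node l ts) → 2 ≤ length ts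

  Branching-NodeAt : ∀ {t s : Cotree n} {p} → Branching t → NodeAt t p s → Branching s
  Branching-NodeAt {p = p} b na r l ts nb = b (p ++ r) l ts (NodeAt-++ na nb)

  Branching⇒nonempty : ∀ (s : Cotree n) → Branching s → ∃[ x ] x ∈ leaves s
  Branching⇒nonempty (leaf x) _ = x , here refl
  Branching⇒nonempty (node l []) b with b [] l [] root
  ... | ()
  Branching⇒nonempty (node l (t ∷ ts)) b with Branching⇒nonempty t (Branching-NodeAt b (child here root))
  ... | x , x∈t = x , ∈-++⁺ˡ x∈t

  another-child : ∀ {ts : List (Cotree n)} {i c} → 2 ≤ length ts → Lookup ts i c →
                  ∃[ j ] ∃[ d ] (j ≢ i × Lookup ts j d)
  another-child {_ ∷ t ∷ _} _       here      = 1 , t , (λ ()) , there here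
  another-child {_ ∷ []}    (s≤s ()) here
  another-child {t ∷ _}     _       (there _) = 0 , t , (λ ()) , here

  childIndex : List (Cotree n) → Fin n → ℕ
  childIndex []       x = 0
  childIndex (t ∷ ts) x with x ∈? leaves t
  ... | yes _ = 0
  ... | no _  = suc (childIndex ts x)

  rootChildIndex : Cotree n → Fin n → ℕ
  rootChildIndex (leaf _)    _ = 0
  rootChildIndex (node _ ts) x = childIndex ts x

  childIndex-correct : ∀ {ts : List (Cotree n)} {i c x} → Unique (leavesL ts) → Lookup ts i c →
                       x ∈ leaves c → childIndex ts x ≡ i
  childIndex-correct {t ∷ ts} {x = x} u here x∈c with x ∈? leaves t
  ... | yes _   = refl
  ... | no x∉t  = contradiction x∈c x∉t
  childIndex-correct {t ∷ ts} {x = x} u (there lk) x∈c with x ∈? leaves t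
  ... | yes x∈t = ⊥-elim (Unique-++⇒Disjoint (leaves t) u (x∈t , ∈-leaves-child lk x∈c))
  ... | no _    = cong suc (childIndex-correct (Unique-++⁻ʳ (leaves t) u) lk x∈c)

  connected-by-lca : ∀ {t : Cotree n} {q l ts} (A : Fin n → Fin n → Set) →
    Unique (leaves t) → Branching t → NodeAt t q (node l ts) →
    (∀ {x y} → x ∈ leavesL ts → y ∈ leavesL ts → x ≢ y → IsLCA t x y q l → A x y) →
    ∀ x y → x ∈ₛ fromList (leavesL ts) → y ∈ₛ fromList (leavesL ts) → Reach A (fromList (leavesL ts)) x y
  connected-by-lca {q = q} {l} {ts} A u b na edge x y x∈ y∈
    with ∈-leavesL⁻ ts (∈-fromList⁻ x∈) | ∈-leavesL⁻ ts (∈-fromList⁻ y∈)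
  ... | i , c , lc , x∈c | j , d , ld , y∈d = route (i ≟ j)
    where
      uts = NodeAt-Unique u na
      across : ∀ {i j c d x y} → Lookup ts i c → Lookup ts j d → i ≢ j →
               x ∈ leaves c → y ∈ leaves d → A x y
      across lc ld i≢j x∈c y∈d =
        edge (∈-leaves-child lc x∈c) (∈-leaves-child ld y∈d)
             (distinct-children⇒≢ uts i≢j lc ld x∈c y∈d) (IsLCA-siblings na uts lc ld i≢j x∈c y∈d)
      route : Dec (i ≡ j) → Reach A (fromList (leavesL ts)) x y
      route (no i≢j) = step x∈ (across lc ld i≢j x∈c y∈d) (stay y∈)
      route (yes i≡j) with another-child (b q l ts na) lc
      ... | i′ , c′ , i′≢i , lc′
        with Branching⇒nonempty c′ (Branching-NodeAt b (NodeAt-++ na (child lc′ root)))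
      ...   | w , w∈c′ =
        step x∈ (across lc lc′ (λ e → i′≢i (≡-sym e)) x∈c w∈c′)
          (step (∈-fromList⁺ (∈-leaves-child lc′ w∈c′))
                (across lc′ ld (λ e → i′≢i (trans e (≡-sym i≡j))) w∈c′ y∈d)
                (stay y∈))

isSeries : Label → Bool
isSeries oplus = true
isSeries plus  = false

isSeries-injective : ∀ {l l′} → isSeries l ≡ isSeries l′ → l ≡ l′
isSeries-injective {oplus} {oplus} _ = refl
isSeries-injective {plus}  {plus}  _ = refl

module _ {n : ℕ} (G : Graph n) where

  EdgeOf : Label → Fin n → Fin n → Set
  EdgeOf oplus = Adj G
  EdgeOf plus  = CoAdj G

  EdgeOf-isSeries : ∀ {l x y} → x ≢ y → adj G x y ≡ isSeries l → EdgeOf l x y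
  EdgeOf-isSeries {oplus} _   e = e
  EdgeOf-isSeries {plus}  x≢y e = x≢y , e

  ¬EdgeOf-isSeries : ∀ {l l′ x y} → l′ ≢ l → adj G x y ≡ isSeries l → ¬ EdgeOf l′ x y
  ¬EdgeOf-isSeries {oplus} {oplus} l′≢l _ _       = l′≢l refl
  ¬EdgeOf-isSeries {oplus} {plus}  _    e (_ , f) = contradiction (trans (≡-sym e) f) λ ()
  ¬EdgeOf-isSeries {plus}  {oplus} _    e f       = contradiction (trans (≡-sym e) f) λ ()
  ¬EdgeOf-isSeries {plus}  {plus}  l′≢l _ _       = l′≢l refl

  EdgeOf-component : ∀ {l C} → IsComponent (EdgeOf l) C →
                     IsComponent (Adj G) C ⊎ IsComponent (CoAdj G) C
  EdgeOf-component {oplus} = inj₁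
  EdgeOf-component {plus}  = inj₂

  comodule-adj-outside : ∀ {C x z z′} → IsComodule G C → x ∈ₛ C → z ∉ₛ C → z′ ∉ₛ C →
                         adj G x z ≡ adj G x z′
  comodule-adj-outside (_ , inj₁ (_ , _ , closed)) x∈ z∉ z′∉ =
    trans (¬-not (closed _ _ x∈ z∉)) (≡-sym (¬-not (closed _ _ x∈ z′∉)))
  comodule-adj-outside (_ , inj₂ (_ , _ , closed)) x∈ z∉ z′∉ =
    trans (¬-not (λ f → closed _ _ x∈ z∉ (outside z∉ x∈ , f)))
          (≡-sym (¬-not (λ f → closed _ _ x∈ z′∉ (outside z′∉ x∈ , f))))
    where
      outside : ∀ {C x z} → z ∉ₛ C → x ∈ₛ C → x ≢ z
      outside z∉ x∈ refl = z∉ x∈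

  independent-or-edge : ∀ M → IsIndependent G M ⊎ ∃[ x ] ∃[ y ] (x ∈ₛ M × y ∈ₛ M × adj G x y ≡ true)
  independent-or-edge M
    with Fin.any? (λ x → Fin.any? (λ y → x ∈ₛ? M ×-dec y ∈ₛ? M ×-dec adj G x y Bool.≟ true))
  ... | yes edge = inj₂ edge
  ... | no ¬edge = inj₁ λ x y x∈ y∈ → ¬-not (λ e → ¬edge (x , y , x∈ , y∈ , e))

  large-noncomodule⇒R2⊎R3 : ∀ {k M} → IsModule G M → suc k < ∣ M ∣ → ¬ IsComodule G M →
                            R2Applies G k ⊎ R3Applies G k
  large-noncomodule⇒R2⊎R3 {M = M} mod large ¬co with independent-or-edge M
  ... | inj₁ indep = inj₁ (M , mod , large , indep)
  ... | inj₂ edge  = inj₂ (M , mod , ¬co , edge)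

  unedited-cograph : ∀ {S : EditSet n} {P : Fin n → Set} → IsCograph (EditAdj G S) →
                     (∀ {x y} → P x → ¬ InS S x y) → ¬ HasInducedP4In (Adj G) P
  unedited-cograph {S} {P} H-cograph unedited
    (a , b , c , d , a∈ , b∈ , c∈ , _ , a≢b , a≢c , a≢d , b≢c , b≢d , c≢d , ab , bc , cd , ¬ac , ¬bd , ¬ad) =
    H-cograph (a , b , c , d , _ , _ , _ , _ , a≢b , a≢c , a≢d , b≢c , b≢d , c≢d ,
               kept a∈ ab , kept b∈ bc , kept c∈ cd , absent a∈ ¬ac , absent b∈ ¬bd , absent a∈ ¬ad)
    where
      kept : ∀ {x y} → P x → Adj G x y → EditAdj G S x y
      kept x∈ e = inj₁ (e , unedited x∈)
      absent : ∀ {x y} → P x → ¬ Adj G x y → ¬ EditAdj G S x y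
      absent x∈ ¬e (inj₁ (e , _))   = ¬e e
      absent x∈ ¬e (inj₂ (_ , xy∈S)) = unedited x∈ xy∈S

module EditedCotree {n : ℕ} (G : Graph n) (S : EditSet n) (T : Cotree n)
                    (T-canonical : IsCanonicalCotree (EditAdj G S) T) where
  open DecMembership (_≟ᶠ_ {n}) using (_∈?_)
  open DecMembership _≟_ using () renaming (_∈?_ to _∈ℕ?_)

  T-unique : Unique (leaves T)
  T-unique = Unique-resp-↭ (↭-sym (proj₁ T-canonical)) (allFin⁺ n)

  ∈-leaves-T : ∀ x → x ∈ leaves T
  ∈-leaves-T x = ∈-resp-↭ (↭-sym (proj₁ T-canonical)) (∈-allFin x)

  T-branching : Branching T
  T-branching = proj₁ (proj₂ T-canonical)

  T-alternating : ∀ {p l ts i l′ ts′} → NodeAt T p (node l ts) → Lookup ts i (node l′ ts′) → l′ ≢ l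
  T-alternating na lk = proj₁ (proj₂ (proj₂ T-canonical)) _ _ _ _ _ _ na lk

  nonempty : ∀ {q s} → NodeAt T q s → ∃[ x ] x ∈ leaves s
  nonempty {s = s} na = Branching⇒nonempty s (Branching-NodeAt T-branching na)

  adj≡isSeries : ∀ {x y q l} → ¬ InS S x y → x ≢ y → IsLCA T x y q l → adj G x y ≡ isSeries l
  adj≡isSeries {x} {y} {q} {l} unedited x≢y lca =
    by-label l (proj₂ (proj₂ (proj₂ T-canonical)) x y q l x≢y lca)
    where
      by-label : ∀ l → (EditAdj G S x y ⇔ (l ≡ oplus)) → adj G x y ≡ isSeries l
      by-label oplus H⇔ with Equivalence.from H⇔ refl
      ... | inj₁ (e , _)    = e
      ... | inj₂ (_ , xy∈S) = contradiction xy∈S unedited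
      by-label plus H⇔ = ¬-not λ e → contradiction (Equivalence.to H⇔ (inj₁ (e , unedited))) λ ()

  Uncrossed : Cotree n → Set
  Uncrossed c = ∀ {a b} → InS S a b → a ∈ leaves c → b ∈ leaves c

  adj-leaving-uncrossed : ∀ {c x z q l} → Uncrossed c → x ∈ leaves c → z ∉ leaves c →
                          IsLCA T x z q l → adj G x z ≡ isSeries l
  adj-leaving-uncrossed uc x∈ z∉ = adj≡isSeries (λ xz∈S → z∉ (uc xz∈S x∈)) λ { refl → z∉ x∈ }

  off-edit-path⇒uncrossed : ∀ {p l ts i c} → NodeAt T p (node l ts) → Lookup ts i c →
                            ¬ OnEditPath T S p i → Uncrossed c
  off-edit-path⇒uncrossed {p} {i = i} {c} na lk off {a} {b} ab a∈c with b ∈? leaves c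
  ... | yes b∈c = b∈c
  ... | no b∉c with lca-outside-child T-unique na lk (∈-leaves-T b) b∉c | leaf-position c a∈c
  ...   | q , l′ , q≼p , lca | r , a-at = ⊥-elim (off (edit-path ab))
    where
      a-below : NodeAt T (p ++ i ∷ r) (leaf a)
      a-below = NodeAt-++ na (child lk a-at)
      below : (p ++ i ∷ []) ≼ (p ++ i ∷ r)
      below = r , ++-assoc p (i ∷ []) r
      edit-path : InS S a b → OnEditPath T S p i
      edit-path (inj₁ ab∈S) =
        a , b , ab∈S , q , l′ , lca a∈c , a , inj₁ refl , _ , a-below , q≼p , below
      edit-path (inj₂ ba∈S) =
        b , a , ba∈S , q , l′ , IsLCA-sym (lca a∈c) , a , inj₂ refl , _ , a-below , q≼p , below

  uncrossed⇒module : ∀ {p l ts i c} → NodeAt T p (node l ts) → Lookup ts i c → Uncrossed c →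
                     IsModule G (fromList (leaves c))
  uncrossed⇒module {c = c} na lk uc x y z x∈ y∈ z∉
    with lca-outside-child T-unique na lk (∈-leaves-T z) (λ z∈ → z∉ (∈-fromList⁺ {xs = leaves c} z∈))
  ... | _ , l′ , _ , lca = trans (towards-z x∈) (≡-sym (towards-z y∈))
    where
      towards-z : ∀ {v} → v ∈ₛ fromList (leaves c) → adj G v z ≡ isSeries l′
      towards-z v∈ =
        adj-leaving-uncrossed {c} uc (∈-fromList⁻ v∈) (λ z∈ → z∉ (∈-fromList⁺ z∈))
          (lca (∈-fromList⁻ v∈))

  large-subtree : ∀ {p c k} → NodeAt T p c → k + 2 ≤ size c → suc k < ∣ fromList (leaves c) ∣
  large-subtree {k = k} na big =
    ≤-trans (≤-reflexive (+-comm 2 k))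
      (≤-trans big (length≤∣ _ ∣ (NodeAt-Unique T-unique na) ∈-fromList⁺))

  mixed-neighbourhood : ∀ {a p l ts i c} → NodeAt T (a ∷ p) (node l ts) → Lookup ts i c → Uncrossed c →
    ∃[ x ] ∃[ z ] ∃[ z′ ] (x ∈ leaves c × z ∉ leaves c × z′ ∉ leaves c × adj G x z ≢ adj G x z′)
  mixed-neighbourhood {a} {p} {l} {ts} {i} {c} na lk uc with NodeAt-parent na
  ... | q , j , lw , tsw , naW , lkW
    with another-child (T-branching _ _ _ na) lk | another-child (T-branching _ _ _ naW) lkW
  ...   | i′ , c′ , i′≢i , lk′ | j′ , d , j′≢j , lkW′
    with nonempty (NodeAt-++ na (child lk root)) | nonempty (NodeAt-++ na (child lk′ root))
       | nonempty (NodeAt-++ naW (child lkW′ root))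
  ...     | x , x∈c | z , z∈c′ | z′ , z′∈d =
    x , z , z′ , x∈c , z∉c , z′∉c ,
    λ e → T-alternating naW lkW (isSeries-injective
      (trans (≡-sym (adj-leaving-uncrossed {c} uc x∈c z∉c lca-xz))
             (trans e (adj-leaving-uncrossed {c} uc x∈c z′∉c lca-xz′))))
    where
      u = NodeAt-Unique T-unique na
      uW = NodeAt-Unique T-unique naW
      z∉c : z ∉ leaves c
      z∉c z∈c = i′≢i (children-disjoint u lk′ lk z∈c′ z∈c)
      z′∉c : z′ ∉ leaves c
      z′∉c z′∈c = j′≢j (children-disjoint uW lkW′ lkW z′∈d (∈-leaves-child lk z′∈c))
      lca-xz : IsLCA T x z (a ∷ p) l
      lca-xz = IsLCA-siblings na u lk lk′ (λ e → i′≢i (≡-sym e)) x∈c z∈c′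
      lca-xz′ : IsLCA T x z′ q lw
      lca-xz′ = IsLCA-siblings naW uW lkW lkW′ (λ e → j′≢j (≡-sym e)) (∈-leaves-child lk x∈c) z′∈d

  editedRootChildren : List ℕ
  editedRootChildren = map (λ ab → rootChildIndex T (proj₁ ab)) S

  ∈-editedRootChildren : ∀ {l ts i c a b} → NodeAt T [] (node l ts) → Lookup ts i c →
                         (a , b) ∈ S → a ∈ leaves c → i ∈ editedRootChildren
  ∈-editedRootChildren {a = a} na lk ab∈S a∈c =
    subst (_∈ editedRootChildren)
      (trans (cong (λ t → rootChildIndex t a) (NodeAt-root na))
             (childIndex-correct (NodeAt-Unique T-unique na) lk a∈c))
      (∈-map⁺ (λ ab → rootChildIndex T (proj₁ ab)) ab∈S)

  unedited-root-child : ∀ {l ts i c x y} → NodeAt T [] (node l ts) → Lookup ts i c →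
                        i ∉ editedRootChildren → Uncrossed c → x ∈ leaves c → ¬ InS S x y
  unedited-root-child na lk i∉ uc x∈c (inj₁ xy∈S) = i∉ (∈-editedRootChildren na lk xy∈S x∈c)
  unedited-root-child na lk i∉ uc x∈c (inj₂ yx∈S) =
    i∉ (∈-editedRootChildren na lk yx∈S (uc (inj₂ yx∈S) x∈c))

  unedited-root-child-comodule : ∀ {l ts i l′ ts′} → NodeAt T [] (node l ts) → Lookup ts i (node l′ ts′) →
    (∀ {x y} → x ∈ leavesL ts′ → ¬ InS S x y) → IsComodule G (fromList (leavesL ts′))
  unedited-root-child-comodule {l} {ts} {i} {l′} {ts′} na lk unedited =
    uncrossed⇒module na lk uncrossed ,
    EdgeOf-component G {l′}
      (inhabited , connected-by-lca (EdgeOf G l′) T-unique T-branching naC edge , closed)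
    where
      uncrossed : Uncrossed (node l′ ts′)
      uncrossed xy∈S x∈ = contradiction xy∈S (unedited x∈)
      naC : NodeAt T (i ∷ []) (node l′ ts′)
      naC = NodeAt-++ na (child lk root)
      inhabited : ∃[ x ] x ∈ₛ fromList (leavesL ts′)
      inhabited with nonempty naC
      ... | x , x∈ = x , ∈-fromList⁺ x∈
      edge : ∀ {x y} → x ∈ leavesL ts′ → y ∈ leavesL ts′ → x ≢ y → IsLCA T x y (i ∷ []) l′ →
             EdgeOf G l′ x y
      edge x∈ _ x≢y lca = EdgeOf-isSeries G x≢y (adj≡isSeries (unedited x∈) x≢y lca)
      closed : ∀ x z → x ∈ₛ fromList (leavesL ts′) → z ∉ₛ fromList (leavesL ts′) → ¬ EdgeOf G l′ x z
      closed x z x∈ z∉ =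
        ¬EdgeOf-isSeries G (T-alternating na lk)
          (adj-leaving-uncrossed {node l′ ts′} uncrossed (∈-fromList⁻ x∈) z∉ts′
            (IsLCA-outside-child na (NodeAt-Unique T-unique na) lk (∈-fromList⁻ x∈) z∈ts z∉ts′))
        where
          z∉ts′ : z ∉ leavesL ts′
          z∉ts′ z∈ = z∉ (∈-fromList⁺ z∈)
          z∈ts : z ∈ leavesL ts
          z∈ts = subst (λ t → z ∈ leaves t) (NodeAt-root na) (∈-leaves-T z)

  module _ {k : ℕ} (irreducible : NoRuleApplies G k) where

    ¬large-uncrossed-below-root : ∀ {a p l ts i c} → NodeAt T (a ∷ p) (node l ts) → Lookup ts i c →
                                  k + 2 ≤ size c → ¬ Uncrossed c
    ¬large-uncrossed-below-root na lk big uc with mixed-neighbourhood na lk uc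
    ... | x , z , z′ , x∈ , z∉ , z′∉ , mixed =
      [ proj₁ (proj₂ irreducible) , proj₂ (proj₂ irreducible) ]′
        (large-noncomodule⇒R2⊎R3 G (uncrossed⇒module na lk uc)
          (large-subtree (NodeAt-++ na (child lk root)) big)
          λ co → mixed (comodule-adj-outside G co (∈-fromList⁺ x∈)
                          (λ z∈ → z∉ (∈-fromList⁻ z∈)) (λ z′∈ → z′∉ (∈-fromList⁻ z′∈))))

    ¬large-unedited-root-child : ∀ {l ts i c} → IsCograph (EditAdj G S) → NodeAt T [] (node l ts) →
      Lookup ts i c → k + 2 ≤ size c → ¬ (∀ {x y} → x ∈ leaves c → ¬ InS S x y)
    ¬large-unedited-root-child {c = leaf _} _ _ _ big _ with ≤-trans (m≤n+m 2 k) big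
    ... | s≤s ()
    ¬large-unedited-root-child {c = node _ ts′} H-cograph na lk _ unedited =
      proj₁ irreducible
        (fromList (leavesL ts′) , unedited-root-child-comodule na lk unedited ,
         unedited-cograph G H-cograph (λ x∈ → unedited (∈-fromList⁻ x∈)))

    root-T'-edge-off-edit-path⇒edited : ∀ {l ts i c} → IsCograph (EditAdj G S) → NodeAt T [] (node l ts) →
      Lookup ts i c → k + 2 ≤ size c → ¬ OnEditPath T S [] i → i ∈ editedRootChildren
    root-T'-edge-off-edit-path⇒edited {i = i} H-cograph na lk big off with i ∈ℕ? editedRootChildren
    ... | yes i∈ = i∈
    ... | no i∉  = ⊥-elim (¬large-unedited-root-child H-cograph na lk big
                     λ {x} {y} → unedited-root-child na lk i∉ (off-edit-path⇒uncrossed na lk off))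

lemma7 : (n k : ℕ) (G : Graph n) → suc k < n → NoRuleApplies G k →
    (S : EditSet n) → IsMinCographEdit G S → length S ≤ k →
    (T : Cotree n) → IsCanonicalCotree (EditAdj G S) T →
    ∃[ R ] (length R ≤ k ×
      (∀ (p : Position) (i : ℕ) → IsT'Edge k T p i → ¬ OnEditPath T S p i →
        (p ≡ [] × i ∈ R)))
lemma7 n k G _ irreducible S S-minimum |S|≤k T T-canonical =
  editedRootChildren , ≤-trans (≤-reflexive (length-map _ S)) |S|≤k , off-edit-path-T'-edge
  where
    open EditedCotree G S T T-canonical
    off-edit-path-T'-edge : ∀ p i → IsT'Edge k T p i → ¬ OnEditPath T S p i →
                            p ≡ [] × i ∈ editedRootChildren
    off-edit-path-T'-edge []      i (_ , _ , _ , na , lk , _ , big) off =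
      refl , root-T'-edge-off-edit-path⇒edited irreducible (proj₁ (proj₂ S-minimum)) na lk big off
    off-edit-path-T'-edge (_ ∷ _) i (_ , _ , _ , na , lk , _ , big) off =
      ⊥-elim (¬large-uncrossed-below-root irreducible na lk big (off-edit-path⇒uncrossed na lk off))
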